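{- Let $r,s$ be coprime positive integers and let $A_{r/s}=\{1\}\cup\{p+\lceil ps/r\rceil : p\ge1\}$. For $a\in A_{r/s}$ define the path $B(a)$ by $B(1)=UD$ and $B(p+\lceil ps/r\rceil)=U(UD)^p(DU)^{\lceil ps/r\rceil-1}D$ for $p\ge1$. Then for every $n\ge0$, the map sending a composition $(a_1,\dots,a_m)$ of $n$ with all parts in $A_{r/s}$ to the path $B(a_1)B(a_2)\cdots B(a_m)\,UD$ is a bijection from the set $C_n^{A_{r/s}}$ of compositions of $n$ with parts in $A_{r/s}$ onto $R_{n+1}^{r/s}$. In particular $|R_{n+1}^{r/s}|=|C_n^{A_{r/s}}|$.
   Context: Let $\mathcal D$ be the set of Dyck paths of height at most $2$: words over $\{U,D\}$ ($U=(1,1)$, $D=(1,-1)$) from $(0,0)$ to $(2n,0)$ never going below the $x$-axis and whose $U$ steps reach ordinate at most $2$; $n$ is the semilength, and the empty path $\varepsilon$ has semilength $0$. Every nonempty $P\in\mathcal D$ has the form $UwD$ where $w$ is a word in the factors $UD$ and $DU$; grouping $w$ into maximal runs gives the factorization $P=U(UD)^{p_1}(DU)^{v_1}(UD)^{p_2}(DU)^{v_2}\cdots(UD)^{p_k}(DU)^{v_k}D$, where $p_1\ge0$ and $v_k\ge0$ may be zero and all other exponents are positive; for $P=UD$ one has $k=0$. For coprime positive integers $r,s$, $R_n^{r/s}$ is the set of paths $P\in\mathcal D$ of semilength $n$ such that $v_i\ge\lceil p_i s/r\rceil$ for every $i=1,\dots,k$. A composition of $n$ is a finite sequence of positive integers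 summing to $n$ (the empty sequence for $n=0$). Note $p\mapsto p+\lceil ps/r\rceil$ is strictly increasing with values $\ge2$, so $B$ is well defined. -}

module Defs where

open import Data.Nat using (ℕ; zero; suc; _+_; _*_; _∸_; _≤_; _<_; _/_)
open import Data.Nat.Properties using (_≟_)
open import Data.List using (List; []; _∷_; _++_; length; concat; map; replicate)
open import Data.Nat.ListAction using (sum)
open import Data.List.Relation.Unary.All using (All)
open import Data.Product using (_×_; _,_; ∃-syntax)
open import Data.Sum using (_⊎_)
open import Data.Unit using (⊤)
open import Data.Maybe using (Maybe; just; nothing)
open import Relation.Nullary.Decidable using (does)
open import Data.Bool using (if_then_else_)
open import Relation.Binary.PropositionalEquality using (_≡_)

-- Steps U = (1,1), D = (1,-1); a path is a word over {U,D}.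
data Step : Set where
  U D : Step

Path : Set
Path = List Step

data Walk : ℕ → Path → Set where
  done : Walk 0 []
  up   : ∀ {h xs} → suc h ≤ 2 → Walk (suc h) xs → Walk h (U ∷ xs)
  down : ∀ {h xs} → Walk h xs → Walk (suc h) (D ∷ xs)

Dyck2 : Path → Set
Dyck2 P = Walk 0 P

Semilength : ℕ → Path → Set
Semilength n P = length P ≡ 2 * n

pow : ℕ → Path → Path
pow k w = concat (replicate k w)

UD DU : Path
UD = U ∷ D ∷ []
DU = D ∷ U ∷ []

-- ⌈a / r⌉ for r ≥ 1 (junk value 0 for r = 0)
ceilDiv : ℕ → ℕ → ℕ
ceilDiv a zero = 0
ceilDiv a (suc r) = (a + r) / suc r

expand : List (ℕ × ℕ) → Path
expand [] = []
expand ((p , v) ∷ rs) = pow p UD ++ pow v DU ++ expand rs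

RunsOK : List (ℕ × ℕ) → Set
RunsOK [] = ⊤
RunsOK ((p , v) ∷ []) = ⊤
RunsOK ((p , v) ∷ (q , u) ∷ rs) = (0 < v) × (0 < q) × RunsOK ((q , u) ∷ rs)

IsFactorization : Path → List (ℕ × ℕ) → Set
IsFactorization P rs = RunsOK rs × (P ≡ U ∷ expand rs ++ D ∷ [])

InR : ℕ → ℕ → ℕ → Path → Set
InR r s n P =
  Dyck2 P × Semilength n P ×
  (∀ rs → IsFactorization P rs →
     All (λ { (p , v) → ceilDiv (p * s) r ≤ v }) rs)

InA : ℕ → ℕ → ℕ → Set
InA r s a = (a ≡ 1) ⊎ (∃[ p ] (1 ≤ p × a ≡ p + ceilDiv (p * s) r))

InC : ℕ → ℕ → ℕ → List ℕ → Set
InC r s n c = All (λ a → 0 < a) c × sum c ≡ n × All (InA r s) c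

findP : ℕ → ℕ → ℕ → ℕ → Maybe ℕ
findP r s a zero = nothing
findP r s a (suc k) =
  if does (a ≟ suc k + ceilDiv (suc k * s) r) then just (suc k) else findP r s a k

-- B(1) = UD, B(p + ⌈ps/r⌉) = U (UD)^p (DU)^{⌈ps/r⌉-1} D  (junk [] off A_{r/s})
B : ℕ → ℕ → ℕ → Path
B r s a with does (a ≟ 1)
... | Data.Bool.true = UD
... | Data.Bool.false with findP r s a a
...   | just p = U ∷ pow p UD ++ pow (ceilDiv (p * s) r ∸ 1) DU ++ D ∷ []
...   | nothing = []

compToPath : ℕ → ℕ → List ℕ → Path
compToPath r s c = concat (map (B r s) c) ++ UD

-- Moving the first U of each block to its end turns B(a) = U t into t U, which is DU for a = 1
-- and the single run (UD)^p (DU)^⌈ps/r⌉ for a = p + ⌈ps/r⌉. Hence B(a₁)⋯B(aₘ) UD = U w D with w the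
-- concatenation of these runs, a path of height ≤ 2 in which every maximal UD-run (UD)^p is followed
-- by at least ⌈ps/r⌉ factors DU. Conversely, a run (p, v) of a path in R splits into the run of the
-- part p + ⌈ps/r⌉ followed by v − ⌈ps/r⌉ parts 1. The runs (p ≥ 1) start with U, DU starts with D,
-- and ⌈ps/r⌉ ≥ 1 for p ≥ 1, so w splits into such pieces in only one way, which gives injectivity.
module Submission where

open import Defs
open import Data.Nat using (ℕ; zero; suc; _+_; _*_; _∸_; _≤_; _<_; z≤n; s≤s)
open import Data.Nat.Properties
open import Data.Nat.DivMod using (/-monoˡ-≤; m<n⇒m/n≡0; m≥n⇒m/n>0)
open import Data.Nat.ListAction using (sum)
open import Data.Nat.Coprimality using (Coprime)
open import Data.List using (List; []; _∷_; _++_; length; concat; concatMap; map; replicate; head)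
open import Data.List.Properties
  using (++-assoc; ++-identityʳ; ++-cancelˡ; length-++; ∷-injectiveʳ; ∷ʳ-injective; concatMap-++; map-replicate)
open import Data.List.Relation.Unary.All using (All; []; _∷_)
open import Data.Maybe using (just)
open import Data.Product using (_×_; _,_; ∃-syntax; proj₁)
import Data.Product as Product
open import Data.Sum using (inj₁; inj₂)
open import Data.Unit using (tt)
open import Data.Empty using (⊥-elim)
open import Function using (_∘_)
open import Relation.Binary.Definitions using (tri<; tri≈; tri>)
open import Relation.Nullary.Decidable using (yes; no; dec-true; dec-false)
open import Relation.Binary.PropositionalEquality

open ≡-Reasoning

pow-++ : ∀ m n (w : Path) → pow m w ++ pow n w ≡ pow (m + n) w
pow-++ zero    n w = refl
pow-++ (suc m) n w = trans (++-assoc w (pow m w) (pow n w)) (cong (w ++_) (pow-++ m n w))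

pow-++-∸ : ∀ {m n} (w X : Path) → m ≤ n → pow n w ++ X ≡ pow m w ++ pow (n ∸ m) w ++ X
pow-++-∸ {m} {n} w X m≤n = begin
  pow n w ++ X                    ≡⟨ cong (λ k → pow k w ++ X) (m+[n∸m]≡n m≤n) ⟨
  pow (m + (n ∸ m)) w ++ X        ≡⟨ cong (_++ X) (pow-++ m (n ∸ m) w) ⟨
  (pow m w ++ pow (n ∸ m) w) ++ X ≡⟨ ++-assoc (pow m w) (pow (n ∸ m) w) X ⟩
  pow m w ++ pow (n ∸ m) w ++ X   ∎

pow-pred-snoc : ∀ k (w : Path) → 0 < k → pow (k ∸ 1) w ++ w ≡ pow k w
pow-pred-snoc (suc k) w _ = begin
  pow k w ++ w          ≡⟨ cong (pow k w ++_) (++-identityʳ w) ⟨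
  pow k w ++ pow 1 w    ≡⟨ pow-++ k 1 w ⟩
  pow (k + 1) w         ≡⟨ cong (λ j → pow j w) (+-comm k 1) ⟩
  pow (suc k) w         ∎

length-pow : ∀ k (w : Path) → length (pow k w) ≡ k * length w
length-pow zero    w = refl
length-pow (suc k) w = trans (length-++ w) (cong (length w +_) (length-pow k w))

head-pow-DU : ∀ {k} (X : Path) → 0 < k → head (pow k DU ++ X) ≢ just U
head-pow-DU {suc k} X _ ()

pow-UD-cancel : ∀ p q {X Y : Path} → head X ≢ just U → head Y ≢ just U →
                pow p UD ++ X ≡ pow q UD ++ Y → p ≡ q × X ≡ Y
pow-UD-cancel zero    zero    _  _  eq = refl , eq
pow-UD-cancel zero    (suc q) hX _  eq = ⊥-elim (hX (cong head eq))
pow-UD-cancel (suc p) zero    _  hY eq = ⊥-elim (hY (cong head (sym eq)))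
pow-UD-cancel (suc p) (suc q) hX hY eq =
  Product.map₁ (cong suc) (pow-UD-cancel p q hX hY (∷-injectiveʳ (∷-injectiveʳ eq)))

pow-DU-≤ : ∀ v m {X Y : Path} → head X ≢ just D → pow v DU ++ X ≡ pow m DU ++ Y → m ≤ v
pow-DU-≤ v       zero    _  _  = z≤n
pow-DU-≤ zero    (suc m) hX eq = ⊥-elim (hX (cong head eq))
pow-DU-≤ (suc v) (suc m) hX eq = s≤s (pow-DU-≤ v m hX (∷-injectiveʳ (∷-injectiveʳ eq)))

walk-pow-UD : ∀ k {X} → Walk 1 X → Walk 1 (pow k UD ++ X)
walk-pow-UD zero    w = w
walk-pow-UD (suc k) w = up ≤-refl (down (walk-pow-UD k w))

walk-pow-DU : ∀ k {X} → Walk 1 X → Walk 1 (pow k DU ++ X)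
walk-pow-DU zero    w = w
walk-pow-DU (suc k) w = down (up (s≤s z≤n) (walk-pow-DU k w))

elevate : Path → Path
elevate w = U ∷ w ++ D ∷ []

elevate-injective : ∀ {v w} → elevate v ≡ elevate w → v ≡ w
elevate-injective {v} {w} eq = proj₁ (∷ʳ-injective v w (∷-injectiveʳ eq))

length-elevate : ∀ {m} w → length w ≡ 2 * m → length (elevate w) ≡ 2 * suc m
length-elevate {m} w len = begin
  suc (length (w ++ D ∷ [])) ≡⟨ cong suc (length-++ w) ⟩
  suc (length w + 1)         ≡⟨ cong suc (+-comm (length w) 1) ⟩
  2 + length w               ≡⟨ cong (2 +_) len ⟩
  2 + 2 * m                  ≡⟨ *-suc 2 m ⟨
  2 * suc m                  ∎

semilength-elevate-unique : ∀ {m n} w → length w ≡ 2 * m → Semilength (suc n) (elevate w) → m ≡ n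
semilength-elevate-unique {m} {n} w len sl =
  suc-injective (*-cancelˡ-≡ (suc m) (suc n) 2 (trans (sym (length-elevate w len)) sl))

pushUD pushDU : List (ℕ × ℕ) → List (ℕ × ℕ)
pushUD []             = (1 , 0) ∷ []
pushUD ((p , v) ∷ rs) = (suc p , v) ∷ rs
pushDU []                 = (0 , 1) ∷ []
pushDU ((zero , v) ∷ rs)  = (0 , suc v) ∷ rs
pushDU ((suc p , v) ∷ rs) = (0 , 1) ∷ (suc p , v) ∷ rs

expand-pushUD : ∀ rs → expand (pushUD rs) ≡ UD ++ expand rs
expand-pushUD []             = refl
expand-pushUD ((p , v) ∷ rs) = ++-assoc UD (pow p UD) _

expand-pushDU : ∀ rs → expand (pushDU rs) ≡ DU ++ expand rs
expand-pushDU []                 = refl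
expand-pushDU ((zero , v) ∷ rs)  = ++-assoc DU (pow v DU) _
expand-pushDU ((suc p , v) ∷ rs) = refl

RunsOK-pushUD : ∀ rs → RunsOK rs → RunsOK (pushUD rs)
RunsOK-pushUD []          _  = tt
RunsOK-pushUD (_ ∷ [])    _  = tt
RunsOK-pushUD (_ ∷ _ ∷ _) ok = ok

RunsOK-pushDU : ∀ rs → RunsOK rs → RunsOK (pushDU rs)
RunsOK-pushDU []                   _            = tt
RunsOK-pushDU ((zero , v) ∷ [])    _            = tt
RunsOK-pushDU ((zero , v) ∷ _ ∷ _) (_ , q , ok) = s≤s z≤n , q , ok
RunsOK-pushDU ((suc p , v) ∷ rs)   ok           = s≤s z≤n , s≤s z≤n , ok

walk-runs : ∀ {xs} → Walk 1 xs → ∃[ rs ] (RunsOK rs × xs ≡ expand rs ++ D ∷ [])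
walk-runs (down done) = [] , tt , refl
walk-runs (up _ (up (s≤s (s≤s ())) _))
walk-runs (up _ (down w)) with rs , ok , refl ← walk-runs w =
  pushUD rs , RunsOK-pushUD rs ok , cong (_++ D ∷ []) (sym (expand-pushUD rs))
walk-runs (down (up _ w)) with rs , ok , refl ← walk-runs w =
  pushDU rs , RunsOK-pushDU rs ok , cong (_++ D ∷ []) (sym (expand-pushDU rs))

RunsOK-tail : ∀ {x} rs → RunsOK (x ∷ rs) → RunsOK rs
RunsOK-tail []      _            = tt
RunsOK-tail (_ ∷ _) (_ , _ , ok) = ok

RunsOK-head-tail : ∀ {x} rs → RunsOK (x ∷ rs) → head (expand rs) ≢ just D
RunsOK-head-tail []                _ ()
RunsOK-head-tail ((suc q , _) ∷ _) _ ()

RunsOK-head-valley : ∀ {p} v rs → RunsOK ((p , v) ∷ rs) → head (pow v DU ++ expand rs) ≢ just U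
RunsOK-head-valley zero    [] _ ()
RunsOK-head-valley (suc v) rs _ ()

ceilDiv-zero : ∀ r → ceilDiv 0 r ≡ 0
ceilDiv-zero zero    = refl
ceilDiv-zero (suc r) = m<n⇒m/n≡0 (n<1+n r)

ceilDiv-mono : ∀ {a b} r → a ≤ b → ceilDiv a r ≤ ceilDiv b r
ceilDiv-mono zero    _   = z≤n
ceilDiv-mono (suc r) a≤b = /-monoˡ-≤ (suc r) (+-monoˡ-≤ r a≤b)

ceilDiv-pos : ∀ {a} r → 0 < r → 0 < a → 0 < ceilDiv a r
ceilDiv-pos {suc a} (suc r) _ _ = m≥n⇒m/n>0 (s≤s (m≤n+m r a))

module Composition (r s : ℕ) (0<r : 0 < r) (0<s : 0 < s) where

  ⌈_·s/r⌉ : ℕ → ℕ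
  ⌈ p ·s/r⌉ = ceilDiv (p * s) r

  ⌈0·s/r⌉≡0 : ⌈ 0 ·s/r⌉ ≡ 0
  ⌈0·s/r⌉≡0 = ceilDiv-zero r

  ⌈suc·s/r⌉>0 : ∀ p → 0 < ⌈ suc p ·s/r⌉
  ⌈suc·s/r⌉>0 p = ceilDiv-pos r 0<r (*-mono-≤ (s≤s (z≤n {p})) 0<s)

  blockSize : ℕ → ℕ
  blockSize p = p + ⌈ p ·s/r⌉

  blockSize-< : ∀ {p q} → p < q → blockSize p < blockSize q
  blockSize-< p<q = +-mono-<-≤ p<q (ceilDiv-mono r (*-monoˡ-≤ s (<⇒≤ p<q)))

  1<blockSize-suc : ∀ p → 1 < blockSize (suc p)
  1<blockSize-suc p = +-mono-≤ (s≤s (z≤n {p})) (⌈suc·s/r⌉>0 p)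

  blockSize-injective : ∀ {p q} → blockSize p ≡ blockSize q → p ≡ q
  blockSize-injective {p} {q} eq with <-cmp p q
  ... | tri< p<q _ _ = ⊥-elim (<-irrefl eq (blockSize-< p<q))
  ... | tri≈ _ p≡q _ = p≡q
  ... | tri> _ _ q<p = ⊥-elim (<-irrefl (sym eq) (blockSize-< q<p))

  findP-blockSize : ∀ {q} k → 0 < q → q ≤ k → findP r s (blockSize q) k ≡ just q
  findP-blockSize {suc _} zero _ ()
  findP-blockSize {q} (suc k) 0<q q≤k with q ≟ suc k
  ... | yes refl rewrite dec-true (blockSize q ≟ blockSize q) refl = refl
  ... | no q≢k rewrite dec-false (blockSize q ≟ blockSize (suc k)) (q≢k ∘ blockSize-injective) =
    findP-blockSize k 0<q (≤-pred (≤∧≢⇒< q≤k q≢k))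

  -- peaks p is the part blockSize (suc p), whose block has suc p peaks at height 2.
  data Part : Set where
    unit  : Part
    peaks : ℕ → Part

  value : Part → ℕ
  value unit      = 1
  value (peaks p) = blockSize (suc p)

  word : Part → Path
  word unit      = DU
  word (peaks p) = pow (suc p) UD ++ pow ⌈ suc p ·s/r⌉ DU

  words : List Part → Path
  words = concatMap word

  B-peaks : ∀ p → B r s (blockSize (suc p)) ≡ U ∷ pow (suc p) UD ++ pow (⌈ suc p ·s/r⌉ ∸ 1) DU ++ D ∷ []
  B-peaks p
    rewrite dec-false (blockSize (suc p) ≟ 1) (λ eq → <-irrefl (sym eq) (1<blockSize-suc p))
          | findP-blockSize (blockSize (suc p)) (s≤s z≤n) (m≤m+n (suc p) _)
    = refl

  B-value : ∀ x → B r s (value x) ++ U ∷ [] ≡ U ∷ word x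
  B-value unit      = refl
  B-value (peaks p) = begin
    B r s (blockSize (suc p)) ++ U ∷ []
      ≡⟨ cong (_++ U ∷ []) (B-peaks p) ⟩
    U ∷ (pow (suc p) UD ++ pow (c ∸ 1) DU ++ D ∷ []) ++ U ∷ []
      ≡⟨ cong (U ∷_) (++-assoc (pow (suc p) UD) (pow (c ∸ 1) DU ++ D ∷ []) (U ∷ [])) ⟩
    U ∷ pow (suc p) UD ++ (pow (c ∸ 1) DU ++ D ∷ []) ++ U ∷ []
      ≡⟨ cong (λ t → U ∷ pow (suc p) UD ++ t) (++-assoc (pow (c ∸ 1) DU) (D ∷ []) (U ∷ [])) ⟩
    U ∷ pow (suc p) UD ++ pow (c ∸ 1) DU ++ DU
      ≡⟨ cong (λ t → U ∷ pow (suc p) UD ++ t) (pow-pred-snoc c DU (⌈suc·s/r⌉>0 p)) ⟩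
    U ∷ pow (suc p) UD ++ pow c DU
      ∎
    where c = ⌈ suc p ·s/r⌉

  compToPath-values : ∀ xs → compToPath r s (map value xs) ≡ elevate (words xs)
  compToPath-values []       = refl
  compToPath-values (x ∷ xs) = begin
    (B r s (value x) ++ concat (map (B r s) (map value xs))) ++ UD
      ≡⟨ ++-assoc (B r s (value x)) _ UD ⟩
    B r s (value x) ++ compToPath r s (map value xs)
      ≡⟨ cong (B r s (value x) ++_) (compToPath-values xs) ⟩
    B r s (value x) ++ U ∷ words xs ++ D ∷ []
      ≡⟨ ++-assoc (B r s (value x)) (U ∷ []) _ ⟨
    (B r s (value x) ++ U ∷ []) ++ words xs ++ D ∷ []
      ≡⟨ cong (_++ words xs ++ D ∷ []) (B-value x) ⟩
    U ∷ word x ++ words xs ++ D ∷ []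
      ≡⟨ cong (U ∷_) (++-assoc (word x) (words xs) (D ∷ [])) ⟨
    elevate (words (x ∷ xs))
      ∎

  walk-word : ∀ x {X} → Walk 1 X → Walk 1 (word x ++ X)
  walk-word unit      w = down (up (s≤s z≤n) w)
  walk-word (peaks p) {X} w =
    subst (Walk 1) (sym (++-assoc (pow (suc p) UD) (pow ⌈ suc p ·s/r⌉ DU) X))
      (walk-pow-UD (suc p) (walk-pow-DU ⌈ suc p ·s/r⌉ w))

  walk-words : ∀ xs {X} → Walk 1 X → Walk 1 (words xs ++ X)
  walk-words []       w = w
  walk-words (x ∷ xs) {X} w =
    subst (Walk 1) (sym (++-assoc (word x) (words xs) X)) (walk-word x (walk-words xs w))

  length-word : ∀ x → length (word x) ≡ 2 * value x
  length-word unit      = refl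
  length-word (peaks p) = begin
    length (pow (suc p) UD ++ pow c DU)         ≡⟨ length-++ (pow (suc p) UD) ⟩
    length (pow (suc p) UD) + length (pow c DU) ≡⟨ cong₂ _+_ (length-pow (suc p) UD) (length-pow c DU) ⟩
    suc p * 2 + c * 2                           ≡⟨ *-distribʳ-+ 2 (suc p) c ⟨
    (suc p + c) * 2                             ≡⟨ *-comm (suc p + c) 2 ⟩
    2 * blockSize (suc p)                       ∎
    where c = ⌈ suc p ·s/r⌉

  length-words : ∀ xs → length (words xs) ≡ 2 * sum (map value xs)
  length-words []       = refl
  length-words (x ∷ xs) = begin
    length (word x ++ words xs)               ≡⟨ length-++ (word x) ⟩
    length (word x) + length (words xs)       ≡⟨ cong₂ _+_ (length-word x) (length-words xs) ⟩
    2 * value x + 2 * sum (map value xs)      ≡⟨ *-distribˡ-+ 2 (value x) _ ⟨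
    2 * sum (map value (x ∷ xs))              ∎

  words-peaks : ∀ p xs → words (peaks p ∷ xs) ≡ pow (suc p) UD ++ pow ⌈ suc p ·s/r⌉ DU ++ words xs
  words-peaks p xs = ++-assoc (pow (suc p) UD) (pow ⌈ suc p ·s/r⌉ DU) (words xs)

  words-injective : ∀ xs ys → words xs ≡ words ys → xs ≡ ys
  words-injective []             []             _  = refl
  words-injective []             (unit ∷ _)     ()
  words-injective []             (peaks _ ∷ _)  ()
  words-injective (unit ∷ _)     []             ()
  words-injective (peaks _ ∷ _)  []             ()
  words-injective (unit ∷ _)     (peaks _ ∷ _)  ()
  words-injective (peaks _ ∷ _)  (unit ∷ _)     ()
  words-injective (unit ∷ xs)    (unit ∷ ys)    eq =
    cong (unit ∷_) (words-injective xs ys (∷-injectiveʳ (∷-injectiveʳ eq)))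
  words-injective (peaks p ∷ xs) (peaks q ∷ ys) eq
    with refl , rest ← pow-UD-cancel (suc p) (suc q)
                         (head-pow-DU (words xs) (⌈suc·s/r⌉>0 p)) (head-pow-DU (words ys) (⌈suc·s/r⌉>0 q))
                         (trans (sym (words-peaks p xs)) (trans eq (words-peaks q ys)))
    = cong (peaks p ∷_) (words-injective xs ys (++-cancelˡ (pow ⌈ suc p ·s/r⌉ DU) (words xs) (words ys) rest))

  strip-units : ∀ v {X} xs → pow v DU ++ X ≡ words xs → ∃[ ys ] X ≡ words ys
  strip-units zero    xs            eq = xs , eq
  strip-units (suc v) []            ()
  strip-units (suc v) (peaks _ ∷ _) ()
  strip-units (suc v) (unit ∷ xs)   eq = strip-units v xs (∷-injectiveʳ (∷-injectiveʳ eq))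

  Balanced : ℕ × ℕ → Set
  Balanced (p , v) = ⌈ p ·s/r⌉ ≤ v

  -- Each maximal UD-run of words xs lies in a single peaks-block, whose DU's follow it.
  words-balanced : ∀ rs xs → RunsOK rs → expand rs ≡ words xs → All Balanced rs
  words-balanced []                 _  _  _  = []
  words-balanced ((zero , v) ∷ rs)  xs ok eq with ys , eq′ ← strip-units v xs eq =
    subst (_≤ v) (sym ⌈0·s/r⌉≡0) z≤n ∷ words-balanced rs ys (RunsOK-tail rs ok) eq′
  words-balanced ((suc p , v) ∷ rs) []             ok ()
  words-balanced ((suc p , v) ∷ rs) (unit ∷ _)     ok ()
  words-balanced ((suc p , v) ∷ rs) (peaks q ∷ xs) ok eq
    with refl , eq₁ ← pow-UD-cancel (suc p) (suc q)
                        (RunsOK-head-valley v rs ok) (head-pow-DU (words xs) (⌈suc·s/r⌉>0 q))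
                        (trans eq (words-peaks q xs))
    = c≤v ∷ (let ys , eq₃ = strip-units (v ∸ c) xs eq₂ in words-balanced rs ys (RunsOK-tail rs ok) eq₃)
    where
    c = ⌈ suc p ·s/r⌉
    c≤v : c ≤ v
    c≤v = pow-DU-≤ v c (RunsOK-head-tail rs ok) eq₁
    eq₂ : pow (v ∸ c) DU ++ expand rs ≡ words xs
    eq₂ = ++-cancelˡ (pow c DU) _ _ (trans (sym (pow-++-∸ DU (expand rs) c≤v)) eq₁)

  build : List (ℕ × ℕ) → List Part
  build []                 = []
  build ((zero , v) ∷ rs)  = replicate v unit ++ build rs
  build ((suc p , v) ∷ rs) = peaks p ∷ replicate (v ∸ ⌈ suc p ·s/r⌉) unit ++ build rs

  words-units-++ : ∀ k xs → words (replicate k unit ++ xs) ≡ pow k DU ++ words xs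
  words-units-++ k xs = begin
    words (replicate k unit ++ xs)            ≡⟨ concatMap-++ word (replicate k unit) xs ⟩
    words (replicate k unit) ++ words xs      ≡⟨ cong (λ ys → concat ys ++ words xs) (map-replicate word k unit) ⟩
    pow k DU ++ words xs                      ∎

  words-build : ∀ rs → All Balanced rs → words (build rs) ≡ expand rs
  words-build []                 []          = refl
  words-build ((zero , v) ∷ rs)  (_ ∷ bal)   =
    trans (words-units-++ v (build rs)) (cong (pow v DU ++_) (words-build rs bal))
  words-build ((suc p , v) ∷ rs) (c≤v ∷ bal) = begin
    words (peaks p ∷ replicate (v ∸ c) unit ++ build rs)
      ≡⟨ words-peaks p (replicate (v ∸ c) unit ++ build rs) ⟩
    pow (suc p) UD ++ pow c DU ++ words (replicate (v ∸ c) unit ++ build rs)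
      ≡⟨ cong (λ t → pow (suc p) UD ++ pow c DU ++ t) (words-units-++ (v ∸ c) (build rs)) ⟩
    pow (suc p) UD ++ pow c DU ++ pow (v ∸ c) DU ++ words (build rs)
      ≡⟨ cong (pow (suc p) UD ++_) (pow-++-∸ DU (words (build rs)) c≤v) ⟨
    pow (suc p) UD ++ pow v DU ++ words (build rs)
      ≡⟨ cong (λ t → pow (suc p) UD ++ pow v DU ++ t) (words-build rs bal) ⟩
    expand ((suc p , v) ∷ rs)
      ∎
    where c = ⌈ suc p ·s/r⌉

  All-InA⇒values : ∀ {c} → All (InA r s) c → ∃[ xs ] map value xs ≡ c
  All-InA⇒values []                             = [] , refl
  All-InA⇒values (inj₁ refl ∷ as)               = Product.map (unit ∷_) (cong (1 ∷_)) (All-InA⇒values as)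
  All-InA⇒values (inj₂ (suc p , _ , refl) ∷ as) =
    Product.map (peaks p ∷_) (cong (blockSize (suc p) ∷_)) (All-InA⇒values as)

  values-InC : ∀ {n} xs → sum (map value xs) ≡ n → InC r s n (map value xs)
  values-InC xs Σ≡n = positive xs , Σ≡n , inA xs
    where
    positive : ∀ xs → All (0 <_) (map value xs)
    positive []             = []
    positive (unit ∷ xs)    = s≤s z≤n ∷ positive xs
    positive (peaks p ∷ xs) = s≤s z≤n ∷ positive xs
    inA : ∀ xs → All (InA r s) (map value xs)
    inA []             = []
    inA (unit ∷ xs)    = inj₁ refl ∷ inA xs
    inA (peaks p ∷ xs) = inj₂ (suc p , s≤s z≤n , refl) ∷ inA xs

  elevate-words-InR : ∀ {n} xs → sum (map value xs) ≡ n → InR r s (suc n) (elevate (words xs))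
  elevate-words-InR xs Σ≡n =
    up (s≤s z≤n) (walk-words xs (down done)) ,
    length-elevate (words xs) (trans (length-words xs) (cong (2 *_) Σ≡n)) ,
    λ rs (ok , eq) → words-balanced rs xs ok (elevate-injective (sym eq))

  InR⇒elevate-words : ∀ {n P} → InR r s (suc n) P → ∃[ xs ] (sum (map value xs) ≡ n × elevate (words xs) ≡ P)
  InR⇒elevate-words {P = []} (_ , () , _)
  InR⇒elevate-words {n} {U ∷ _} (up _ w , len , balanced) with rs , ok , refl ← walk-runs w =
    build rs ,
    semilength-elevate-unique (words (build rs)) (length-words (build rs))
      (subst (Semilength (suc n) ∘ elevate) (sym build-ok) len) ,
    cong elevate build-ok
    where
    build-ok : words (build rs) ≡ expand rs
    build-ok = words-build rs (balanced rs (ok , refl))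

mainTheorem2 : (r s : ℕ) → 0 < r → 0 < s → Coprime r s → (n : ℕ) →
    (∀ c → InC r s n c → InR r s (suc n) (compToPath r s c))
    × (∀ c c′ → InC r s n c → InC r s n c′ →
         compToPath r s c ≡ compToPath r s c′ → c ≡ c′)
    × (∀ P → InR r s (suc n) P →
         ∃[ c ] (InC r s n c × compToPath r s c ≡ P))
mainTheorem2 r s 0<r 0<s _ n = well-defined , injective , surjective
  where
  open Composition r s 0<r 0<s

  well-defined : ∀ c → InC r s n c → InR r s (suc n) (compToPath r s c)
  well-defined c (_ , Σ≡n , c∈A) with xs , refl ← All-InA⇒values c∈A
    rewrite compToPath-values xs = elevate-words-InR xs Σ≡n

  injective : ∀ c c′ → InC r s n c → InC r s n c′ → compToPath r s c ≡ compToPath r s c′ → c ≡ c′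
  injective c c′ (_ , _ , c∈A) (_ , _ , c′∈A) eq
    with xs , refl ← All-InA⇒values c∈A | ys , refl ← All-InA⇒values c′∈A
    = cong (map value) (words-injective xs ys (elevate-injective
        (trans (sym (compToPath-values xs)) (trans eq (compToPath-values ys)))))

  surjective : ∀ P → InR r s (suc n) P → ∃[ c ] (InC r s n c × compToPath r s c ≡ P)
  surjective P P∈R with xs , Σ≡n , refl ← InR⇒elevate-words P∈R =
    map value xs , values-InC xs Σ≡n , compToPath-values xs
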